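{- Let $n\ge 1$ and let $\mathcal{D}$ be a de Bruijn sequence of order $n$, written as a linear binary string of length $2^n$. Then $\operatorname{disc}(\mathcal{D})=d_0(\mathcal{D})+d_1(\mathcal{D})$.
   Context: A de Bruijn sequence of order $n$ is a circular binary string of length $2^n$ containing every binary string of length $n$ as a (circular) substring exactly once. For a binary string $w$ and a symbol $a$, $|w|_a$ is the number of occurrences of $a$ in $w$. $\operatorname{csub}(w)$ denotes the set of all substrings of $w$ when $w$ is interpreted as a circular string (including the empty string), and $\operatorname{disc}(w)=\max_{u\in \operatorname{csub}(w)}\big|\,|u|_1-|u|_0\,\big|$. For a binary string $w$, $d_0(w)=\max_{w=uv}(|u|_0-|u|_1)$ and $d_1(w)=\max_{w=uv}(|u|_1-|u|_0)$, the maxima taken over all factorizations $w=uv$ (i.e., over all prefixes $u$ of $w$, including the empty prefix). -}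

module Defs where

open import Data.Bool using (Bool; true; false)
open import Data.Nat using (ℕ; zero; suc; _^_)
open import Data.Integer using (ℤ; +_; _-_; ∣_∣; _⊔_)
import Data.Nat as ℕ
open import Data.List using (List; []; _∷_; length; take; drop; _++_; upTo; map; concatMap; inits; filter; foldr)
open import Relation.Binary.PropositionalEquality using (_≡_)
open import Data.List.Properties using (≡-dec)
open import Data.Bool.Properties using () renaming (_≟_ to _≟ᵇ_)

-- Binary strings: lists of Bool, with true = symbol 1 and false = symbol 0.
Word : Set
Word = List Bool

count₁ : Word → ℕ
count₁ [] = 0
count₁ (true ∷ w) = suc (count₁ w)
count₁ (false ∷ w) = count₁ w

count₀ : Word → ℕ
count₀ [] = 0
count₀ (false ∷ w) = suc (count₀ w)
count₀ (true ∷ w) = count₀ w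

maxℕ : List ℕ → ℕ
maxℕ = foldr ℕ._⊔_ 0

-- Circular substring of w starting at position i with length k
-- (i < |w|, k ≤ |w|): read w ++ w from position i.
csubAt : Word → ℕ → ℕ → Word
csubAt w i k = take k (drop i (w ++ w))

-- csub(w): all circular substrings of w (the empty word is included, k = 0;
-- when w is empty this list is empty, which doesn't affect disc since the
-- maximum over the empty word alone is 0).
csub : Word → List Word
csub w = concatMap (λ i → map (csubAt w i) (upTo (suc (length w)))) (upTo (length w))

disc : Word → ℕ
disc w = maxℕ (map (λ u → ∣ + count₁ u - + count₀ u ∣) (csub w))

maxℤ : List ℤ → ℤ
maxℤ = foldr _⊔_ (+ 0)

d₀ : Word → ℤ
d₀ w = maxℤ (map (λ u → + count₀ u - + count₁ u) (inits w))

d₁ : Word → ℤ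
d₁ w = maxℤ (map (λ u → + count₁ u - + count₀ u) (inits w))

occurrences : Word → Word → ℕ
occurrences w u = length (filter (λ i → ≡-dec _≟ᵇ_ (csubAt w i (length u)) u) (upTo (length w)))

IsDeBruijn : ℕ → Word → Set
IsDeBruijn n w = (length w ≡ 2 ^ n) × ((u : Word) → length u ≡ n → occurrences w u ≡ 1)
  where open import Data.Product using (_×_)

-- Write weight(u) = |u|₁ - |u|₀ and H(j) = weight of the prefix of length j.
-- Then d₁(w) = max_j H(j) and d₀(w) = max_j (-H(j)), while every circular
-- substring of w is a segment of w ++ w, whose weight is a difference
-- H₂(i + k) - H₂(i) of prefix weights of w ++ w.
--
-- 1. A de Bruijn sequence of order n ≥ 1 is balanced, |D|₁ = |D|₀:
--    flipping the first bit of the length-n window at a position carrying b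
--    gives a window occurring (exactly once) at a position carrying ¬b, and
--    this assignment is injective; so #b ≤ #¬b for both b.
-- 2. For every balanced word D the prefix weights of D ++ D are prefix
--    weights of D, hence each circular substring has |weight| ≤ d₀ + d₁.
--    Conversely, the segment between a prefix attaining d₁ and one attaining
--    d₀ is a circular substring of weight ±(d₀ + d₁).
module Submission where

open import Defs
open import Data.Nat using (ℕ; _≥_)
open import Data.Integer using (+_; _+_)
open import Relation.Binary.PropositionalEquality using (_≡_)

open import Data.Bool using (Bool; true; false; not)
open import Data.Bool.Properties using (not-involutive) renaming (_≟_ to _≟ᵇ_)
import Data.Nat as ℕ
open import Data.Nat using (zero; suc; z≤n; s≤s; z<s; _≤_; _<_; _∸_; _^_)
import Data.Nat.Properties as ℕP
open import Data.Integer as ℤ using (ℤ; -[1+_]; -_; _-_; ∣_∣; +≤+)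
import Data.Integer.Properties as ℤP
open import Data.Integer.Tactic.RingSolver using (solve-∀)
open import Data.Maybe as Maybe using (just)
open import Data.List
  using (List; []; _∷_; length; take; drop; _++_; upTo; map; inits; filter; head)
open import Data.List.Properties
  using (length-map; length-take; length-drop; length-++; length-removeAt′; ≡-dec; take-all; ++-identityʳ;
         foldr-preservesᵇ; foldr-preservesᵒ)
open import Data.List.Relation.Unary.Any as Any using (here; there)
import Data.List.Relation.Unary.All as All
open import Data.List.Relation.Unary.All.Properties as AllP using ()
open import Data.List.Relation.Unary.Unique.Propositional using (Unique; []; _∷_)
import Data.List.Relation.Unary.Unique.Propositional.Properties as UniqueP
open import Data.List.Membership.Propositional using (_∈_; find; lose)
open import Data.List.Membership.Propositional.Properties
  using (∈-map⁺; ∈-map⁻; ∈-concatMap⁺; ∈-concatMap⁻; ∈-upTo⁺; ∈-upTo⁻; ∈-filter⁺; ∈-filter⁻; foldr-selective)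
open import Data.Product using (∃; _×_; _,_; proj₁; proj₂)
open import Data.Sum using (inj₁; inj₂; [_,_])
open import Data.Empty using (⊥-elim)
open import Relation.Nullary using (yes; no)
open import Relation.Unary using (Decidable)
open import Relation.Binary.PropositionalEquality
  using (_≢_; refl; sym; trans; cong; cong₂; subst; subst₂; module ≡-Reasoning)
open import Data.Maybe.Properties using (just-injective)
open import Function using (_∘_)

module _ {A : Set} where

  ∈-─ : ∀ {x y} {ys : List A} (p : x ∈ ys) → y ∈ ys → y ≢ x → y ∈ (ys Any.─ p)
  ∈-─ (here refl) (here refl) y≢x = ⊥-elim (y≢x refl)
  ∈-─ (here refl) (there q)   _   = q
  ∈-─ (there p)   (here refl) _   = here refl
  ∈-─ (there p)   (there q)   y≢x = there (∈-─ p q y≢x)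

  -- A duplicate-free list xs that injects into ys is no longer than ys.
  -- The injection is given on membership proofs, so it need only be
  -- defined on the members of xs.
  injection-length : ∀ {xs ys : List A} → Unique xs →
    (f : ∀ {x} → x ∈ xs → A) → (∀ {x} (p : x ∈ xs) → f p ∈ ys) →
    (∀ {x y} (p : x ∈ xs) (q : y ∈ xs) → f p ≡ f q → x ≡ y) →
    length xs ≤ length ys
  injection-length {[]} _ _ _ _ = z≤n
  injection-length {x ∷ xs} {ys} (x∉ ∷ uniq) f into inj =
    subst (suc (length xs) ≤_) (sym (length-removeAt′ ys (Any.index fx∈)))
      (s≤s (injection-length uniq (λ p → f (there p)) into′ (λ p q → inj (there p) (there q))))
    where
    fx∈ = into (here refl)
    into′ : ∀ {y} (p : y ∈ xs) → f (there p) ∈ (ys Any.─ fx∈)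
    into′ p = ∈-─ fx∈ (into (there p))
      (λ eq → All.lookup x∉ (subst (_∈ xs) (inj (there p) (here refl) eq) p) refl)

  filter-singleton : ∀ {P : A → Set} (P? : Decidable P) xs →
    length (filter P? xs) ≡ 1 →
    ∃ λ j → j ∈ xs × P j × (∀ {i} → i ∈ xs → P i → i ≡ j)
  filter-singleton {P} P? xs len with filter P? xs in eq
  ... | j ∷ [] = j , proj₁ j∈ , proj₂ j∈ , unique
    where
    j∈ = ∈-filter⁻ P? (subst (j ∈_) (sym eq) (here refl))
    unique : ∀ {i} → i ∈ xs → P i → i ≡ j
    unique i∈ Pi with subst (_ ∈_) eq (∈-filter⁺ P? i∈ Pi)
    ... | here i≡j = i≡j

  take-+ : ∀ i k (xs : List A) → take (i ℕ.+ k) xs ≡ take i xs ++ take k (drop i xs)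
  take-+ zero    k xs       = refl
  take-+ (suc i) zero    [] = refl
  take-+ (suc i) (suc k) [] = refl
  take-+ (suc i) k (x ∷ xs) = cong (x ∷_) (take-+ i k xs)

  take-++ : ∀ j (xs ys : List A) → take j (xs ++ ys) ≡ take j xs ++ take (j ∸ length xs) ys
  take-++ zero    []       ys = refl
  take-++ zero    (x ∷ xs) ys = refl
  take-++ (suc j) []       ys = refl
  take-++ (suc j) (x ∷ xs) ys = cong (x ∷_) (take-++ j xs ys)

  head-drop-++ : ∀ i (xs ys : List A) → i < length xs → head (drop i (xs ++ ys)) ≡ head (drop i xs)
  head-drop-++ zero    (x ∷ xs) ys _         = refl
  head-drop-++ (suc i) (x ∷ xs) ys (s≤s i<) = head-drop-++ i xs ys i<

  head-take-suc : ∀ k (xs : List A) → head (take (suc k) xs) ≡ head xs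
  head-take-suc k []       = refl
  head-take-suc k (x ∷ xs) = refl

  head-drop⇒< : ∀ i (xs : List A) {a} → head (drop i xs) ≡ just a → i < length xs
  head-drop⇒< zero    (x ∷ xs) _ = z<s
  head-drop⇒< (suc i) (x ∷ xs) h = s≤s (head-drop⇒< i xs h)

  take∈inits : ∀ j (xs : List A) → take j xs ∈ inits xs
  take∈inits zero    xs       = here refl
  take∈inits (suc j) []       = here refl
  take∈inits (suc j) (x ∷ xs) = there (∈-map⁺ (x ∷_) (take∈inits j xs))

  ∈inits⇒take : ∀ {u} (xs : List A) → u ∈ inits xs → ∃ λ j → j ≤ length xs × u ≡ take j xs
  ∈inits⇒take []       (here refl) = 0 , z≤n , refl
  ∈inits⇒take (x ∷ xs) (here refl) = 0 , z≤n , refl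
  ∈inits⇒take (x ∷ xs) (there p) with ∈-map⁻ (x ∷_) p
  ... | v , v∈ , refl with ∈inits⇒take xs v∈
  ...   | j , j≤ , refl = suc j , s≤s j≤ , refl

maxℕ-upper : ∀ {x xs} → x ∈ xs → x ≤ maxℕ xs
maxℕ-upper {x} {xs} x∈ = foldr-preservesᵒ
  (λ a b → [ ℕP.m≤n⇒m≤n⊔o b , ℕP.m≤n⇒m≤o⊔n a ]) 0 xs (inj₂ (Any.map ℕP.≤-reflexive x∈))

maxℕ-least : ∀ {t} xs → (∀ {x} → x ∈ xs → x ≤ t) → maxℕ xs ≤ t
maxℕ-least xs bound = foldr-preservesᵇ ℕP.⊔-lub z≤n (All.tabulate bound)

maxℤ-upper : ∀ {x xs} → x ∈ xs → x ℤ.≤ maxℤ xs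
maxℤ-upper {x} {xs} x∈ = foldr-preservesᵒ
  (λ a b → [ ℤP.i≤j⇒i≤j⊔k b , ℤP.i≤j⇒i≤k⊔j a ]) (+ 0) xs (inj₂ (Any.map ℤP.≤-reflexive x∈))

prefix-max-upper : ∀ (f : Word → ℤ) j w → f (take j w) ℤ.≤ maxℤ (map f (inits w))
prefix-max-upper f j w = maxℤ-upper (∈-map⁺ f (take∈inits j w))

prefix-max-attained : ∀ (f : Word → ℤ) w → f [] ≡ + 0 →
  ∃ λ j → j ≤ length w × maxℤ (map f (inits w)) ≡ f (take j w)
prefix-max-attained f w f[]≡0 with foldr-selective ℤP.⊔-sel (+ 0) (map f (inits w))
... | inj₁ max≡0 = 0 , z≤n , trans max≡0 (sym f[]≡0)
... | inj₂ max∈ with ∈-map⁻ f max∈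
...   | u , u∈ , max≡fu with ∈inits⇒take w u∈
...     | j , j≤ , refl = j , j≤ , max≡fu

weight : Word → ℤ
weight u = + count₁ u - + count₀ u

count₁-++ : ∀ u v → count₁ (u ++ v) ≡ count₁ u ℕ.+ count₁ v
count₁-++ []          v = refl
count₁-++ (true ∷ u)  v = cong suc (count₁-++ u v)
count₁-++ (false ∷ u) v = count₁-++ u v

count₀-++ : ∀ u v → count₀ (u ++ v) ≡ count₀ u ℕ.+ count₀ v
count₀-++ []          v = refl
count₀-++ (false ∷ u) v = cong suc (count₀-++ u v)
count₀-++ (true ∷ u)  v = count₀-++ u v

weight-++ : ∀ u v → weight (u ++ v) ≡ weight u + weight v
weight-++ u v = begin
  + count₁ (u ++ v) - + count₀ (u ++ v)
    ≡⟨ cong₂ (λ a b → + a - + b) (count₁-++ u v) (count₀-++ u v) ⟩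
  + (count₁ u ℕ.+ count₁ v) - + (count₀ u ℕ.+ count₀ v)
    ≡⟨ cong₂ _-_ (ℤP.pos-+ (count₁ u) (count₁ v)) (ℤP.pos-+ (count₀ u) (count₀ v)) ⟩
  (+ count₁ u + + count₁ v) - (+ count₀ u + + count₀ v)
    ≡⟨ regroup (+ count₁ u) (+ count₁ v) (+ count₀ u) (+ count₀ v) ⟩
  weight u + weight v ∎
  where
  open ≡-Reasoning
  regroup : ∀ a b c d → (a + b) - (c + d) ≡ (a - c) + (b - d)
  regroup = solve-∀

segment-weight : ∀ i k (xs : Word) →
  weight (take k (drop i xs)) ≡ weight (take (i ℕ.+ k) xs) - weight (take i xs)
segment-weight i k xs = begin
  weight (take k (drop i xs))                           ≡⟨ cancel (weight (take i xs)) _ ⟩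
  (weight (take i xs) + weight (take k (drop i xs))) - weight (take i xs)
    ≡⟨ cong (_- weight (take i xs)) (sym (weight-++ (take i xs) _)) ⟩
  weight (take i xs ++ take k (drop i xs)) - weight (take i xs)
    ≡⟨ cong (λ u → weight u - weight (take i xs)) (sym (take-+ i k xs)) ⟩
  weight (take (i ℕ.+ k) xs) - weight (take i xs) ∎
  where
  open ≡-Reasoning
  cancel : ∀ a b → b ≡ (a + b) - a
  cancel = solve-∀

d₁-upper : ∀ j w → weight (take j w) ℤ.≤ d₁ w
d₁-upper = prefix-max-upper weight

-- d₀ maximises the weight with the roles of 0 and 1 exchanged, i.e. -weight.
reversed-weight : ∀ u → + count₀ u - + count₁ u ≡ - weight u
reversed-weight u = negate (+ count₁ u) (+ count₀ u)
  where
  negate : ∀ a b → b - a ≡ - (a - b)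
  negate = solve-∀

d₀-upper : ∀ j w → - weight (take j w) ℤ.≤ d₀ w
d₀-upper j w = subst (ℤ._≤ d₀ w) (reversed-weight (take j w))
  (prefix-max-upper (λ u → + count₀ u - + count₁ u) j w)

d₁-attained : ∀ w → ∃ λ j → j ≤ length w × d₁ w ≡ weight (take j w)
d₁-attained w = prefix-max-attained weight w refl

d₀-attained : ∀ w → ∃ λ j → j ≤ length w × d₀ w ≡ - weight (take j w)
d₀-attained w with prefix-max-attained (λ u → + count₀ u - + count₁ u) w refl
... | j , j≤ , eq = j , j≤ , trans eq (reversed-weight (take j w))

d₀+d₁-nonneg : ∀ w → + 0 ℤ.≤ d₀ w + d₁ w
d₀+d₁-nonneg w = ℤP.+-mono-≤ (d₀-upper 0 w) (d₁-upper 0 w)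

∣∣-bound : ∀ z m → z ℤ.≤ m → - z ℤ.≤ m → ∣ z ∣ ≤ ∣ m ∣
∣∣-bound (+ _)    (+ _)    (+≤+ z≤m) _          = z≤m
∣∣-bound -[1+ _ ] (+ _)    _          (+≤+ z≤m) = z≤m
∣∣-bound (+ _)    -[1+ _ ] () _
∣∣-bound -[1+ _ ] -[1+ _ ] _ ()

difference-bound : ∀ {p q} x y → x ℤ.≤ q → - x ℤ.≤ p → y ℤ.≤ q → - y ℤ.≤ p → ∣ x - y ∣ ≤ ∣ p + q ∣
difference-bound {p} {q} x y x≤q -x≤p y≤q -y≤p = ∣∣-bound (x - y) (p + q)
  (subst (x - y ℤ.≤_) (ℤP.+-comm q p) (ℤP.+-mono-≤ x≤q -y≤p))
  (subst (ℤ._≤ p + q) (sym (negate x y)) (ℤP.+-mono-≤ -x≤p y≤q))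
  where
  negate : ∀ a b → - (a - b) ≡ - a + b
  negate = solve-∀

windowsFrom : Word → ℕ → List Word
windowsFrom w i = map (csubAt w i) (upTo (suc (length w)))

csubAt∈csub : ∀ {i k} (w : Word) → i < length w → k ≤ length w → csubAt w i k ∈ csub w
csubAt∈csub {i} w i< k≤ = ∈-concatMap⁺ (windowsFrom w) (lose (∈-upTo⁺ i<) (∈-map⁺ (csubAt w i) (∈-upTo⁺ (s≤s k≤))))

∈csub⇒csubAt : ∀ {u} (w : Word) → u ∈ csub w → ∃ λ i → ∃ λ k → u ≡ csubAt w i k
∈csub⇒csubAt {u} w u∈ with find (∈-concatMap⁻ (windowsFrom w) {xs = upTo (length w)} {y = u} u∈)
... | i , _ , u∈i with ∈-map⁻ (csubAt w i) {xs = upTo (suc (length w))} u∈i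
...   | k , _ , u≡ = i , k , u≡

csubAt-disc : ∀ {i k} (w : Word) → i < length w → k ≤ length w → ∣ weight (csubAt w i k) ∣ ≤ disc w
csubAt-disc w i< k≤ = maxℕ-upper (∈-map⁺ (λ u → ∣ weight u ∣) (csubAt∈csub w i< k≤))

-- Part 2: disc = d₀ + d₁ for balanced nonempty words

module Balanced (D : Word) (balanced : weight D ≡ + 0) (nonempty : 0 < length D) where

  L : ℕ
  L = length D

  H : ℕ → ℤ
  H j = weight (take j D)

  prefix-of-DD : ∀ {j} → j ≤ L → take j (D ++ D) ≡ take j D
  prefix-of-DD {j} j≤ = begin
    take j (D ++ D)               ≡⟨ take-++ j D D ⟩
    take j D ++ take (j ∸ L) D    ≡⟨ cong (λ t → take j D ++ take t D) (ℕP.m≤n⇒m∸n≡0 j≤) ⟩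
    take j D ++ []                ≡⟨ ++-identityʳ (take j D) ⟩
    take j D                      ∎
    where open ≡-Reasoning

  -- Since D is balanced, prefix weights of D ++ D are prefix weights of D.
  DD-height : ∀ j → ∃ λ j′ → weight (take j (D ++ D)) ≡ H j′
  DD-height j with j ℕP.≤? L
  ... | yes j≤ = j , cong weight (prefix-of-DD j≤)
  ... | no  j≰ = j ∸ L , (begin
    weight (take j (D ++ D))               ≡⟨ cong weight (take-++ j D D) ⟩
    weight (take j D ++ take (j ∸ L) D)    ≡⟨ weight-++ (take j D) _ ⟩
    weight (take j D) + H (j ∸ L)          ≡⟨ cong (λ u → weight u + H (j ∸ L)) (take-all j D L≤j) ⟩
    weight D + H (j ∸ L)                   ≡⟨ cong (_+ H (j ∸ L)) balanced ⟩
    + 0 + H (j ∸ L)                        ≡⟨ ℤP.+-identityˡ _ ⟩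
    H (j ∸ L)                              ∎)
    where
    open ≡-Reasoning
    L≤j : L ≤ j
    L≤j = ℕP.<⇒≤ (ℕP.≰⇒> j≰)

  DD-height≤d₁ : ∀ j → weight (take j (D ++ D)) ℤ.≤ d₁ D
  DD-height≤d₁ j with DD-height j
  ... | j′ , eq = subst (ℤ._≤ d₁ D) (sym eq) (d₁-upper j′ D)

  -DD-height≤d₀ : ∀ j → - weight (take j (D ++ D)) ℤ.≤ d₀ D
  -DD-height≤d₀ j with DD-height j
  ... | j′ , eq = subst (ℤ._≤ d₀ D) (cong -_ (sym eq)) (d₀-upper j′ D)

  -- Every circular substring, a segment of D ++ D, has |weight| ≤ d₀ + d₁.
  circular-bound : ∀ i k → ∣ weight (csubAt D i k) ∣ ≤ ∣ d₀ D + d₁ D ∣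
  circular-bound i k = subst (λ z → ∣ z ∣ ≤ ∣ d₀ D + d₁ D ∣) (sym (segment-weight i k (D ++ D)))
    (difference-bound (weight (take (i ℕ.+ k) (D ++ D))) (weight (take i (D ++ D)))
      (DD-height≤d₁ (i ℕ.+ k)) (-DD-height≤d₀ (i ℕ.+ k)) (DD-height≤d₁ i) (-DD-height≤d₀ i))

  upper : + disc D ℤ.≤ d₀ D + d₁ D
  upper = subst (+ disc D ℤ.≤_) (ℤP.0≤i⇒+∣i∣≡i (d₀+d₁-nonneg D))
    (+≤+ (maxℕ-least (map (λ u → ∣ weight u ∣) (csub D)) bound))
    where
    bound : ∀ {x} → x ∈ map (λ u → ∣ weight u ∣) (csub D) → x ≤ ∣ d₀ D + d₁ D ∣
    bound x∈ with ∈-map⁻ (λ u → ∣ weight u ∣) x∈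
    ... | u , u∈ , refl with ∈csub⇒csubAt D u∈
    ...   | i , k , refl = circular-bound i k

  -- Balance makes the full prefix look like the empty one, so every prefix
  -- weight is attained by a prefix shorter than D.
  shorten : ∀ j → j ≤ L → ∃ λ j′ → j′ < L × H j ≡ H j′
  shorten j j≤ with ℕP.m≤n⇒m<n∨m≡n j≤
  ... | inj₁ j<  = j , j< , refl
  ... | inj₂ refl = 0 , nonempty , trans (cong weight (take-all L D ℕP.≤-refl)) balanced

  -- The segment of D between positions i ≤ j is a circular substring.
  gap≤disc : ∀ i j → i ≤ j → j < L → ∣ H j - H i ∣ ≤ disc D
  gap≤disc i j i≤j j< = subst (_≤ disc D) (cong ∣_∣ segment)
    (csubAt-disc D (ℕP.≤-<-trans i≤j j<) (ℕP.≤-trans (ℕP.m∸n≤m j i) (ℕP.<⇒≤ j<)))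
    where
    open ≡-Reasoning
    segment : weight (csubAt D i (j ∸ i)) ≡ H j - H i
    segment = begin
      weight (csubAt D i (j ∸ i))
        ≡⟨ segment-weight i (j ∸ i) (D ++ D) ⟩
      weight (take (i ℕ.+ (j ∸ i)) (D ++ D)) - weight (take i (D ++ D))
        ≡⟨ cong (λ t → weight (take t (D ++ D)) - weight (take i (D ++ D))) (ℕP.m+[n∸m]≡n i≤j) ⟩
      weight (take j (D ++ D)) - weight (take i (D ++ D))
        ≡⟨ cong₂ (λ u v → weight u - weight v) (prefix-of-DD (ℕP.<⇒≤ j<))
                 (prefix-of-DD (ℕP.≤-trans i≤j (ℕP.<⇒≤ j<))) ⟩
      H j - H i ∎

  height-gap≤disc : ∀ a b → a < L → b < L → ∣ H a - H b ∣ ≤ disc D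
  height-gap≤disc a b a< b< with ℕP.≤-total b a
  ... | inj₁ b≤a = gap≤disc b a b≤a a<
  ... | inj₂ a≤b = subst (_≤ disc D) (ℤP.∣i-j∣≡∣j-i∣ (H b) (H a)) (gap≤disc a b a≤b b<)

  -- The segment between a prefix attaining d₀ and one attaining d₁ has
  -- weight ±(d₀ + d₁).
  lower : d₀ D + d₁ D ℤ.≤ + disc D
  lower with d₁-attained D | d₀-attained D
  ... | a₀ , a₀≤ , d₁≡ | b₀ , b₀≤ , d₀≡ with shorten a₀ a₀≤ | shorten b₀ b₀≤
  ... | a , a< , Ha₀≡ | b , b< , Hb₀≡ = begin
    d₀ D + d₁ D           ≡⟨ sym (ℤP.0≤i⇒+∣i∣≡i (d₀+d₁-nonneg D)) ⟩
    + ∣ d₀ D + d₁ D ∣     ≡⟨ cong (λ z → + ∣ z ∣) spread ⟩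
    + ∣ H a - H b ∣       ≤⟨ +≤+ (height-gap≤disc a b a< b<) ⟩
    + disc D ∎
    where
    open ℤP.≤-Reasoning
    spread : d₀ D + d₁ D ≡ H a - H b
    spread = trans (cong₂ _+_ (trans d₀≡ (cong -_ Hb₀≡)) (trans d₁≡ Ha₀≡)) (ℤP.+-comm (- H b) (H a))

  disc≡d₀+d₁ : + disc D ≡ d₀ D + d₁ D
  disc≡d₀+d₁ = ℤP.≤-antisym upper lower

balanced-disc : ∀ D → weight D ≡ + 0 → + disc D ≡ d₀ D + d₁ D
balanced-disc []           _   = refl
balanced-disc D@(_ ∷ _)    bal = Balanced.disc≡d₀+d₁ D bal z<s

-- Part 1: de Bruijn sequences are balanced

count : Bool → Word → ℕ
count true  w = count₁ w
count false w = count₀ w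

positions : Bool → Word → List ℕ
positions b []      = []
positions b (x ∷ w) with x ≟ᵇ b
... | yes _ = 0 ∷ map suc (positions b w)
... | no  _ = map suc (positions b w)

length-positions : ∀ b w → length (positions b w) ≡ count b w
length-positions true  []          = refl
length-positions false []          = refl
length-positions true  (true ∷ w)  = cong suc (trans (length-map suc (positions true w)) (length-positions true w))
length-positions true  (false ∷ w) = trans (length-map suc (positions true w)) (length-positions true w)
length-positions false (true ∷ w)  = trans (length-map suc (positions false w)) (length-positions false w)
length-positions false (false ∷ w) = cong suc (trans (length-map suc (positions false w)) (length-positions false w))

unique-positions : ∀ b w → Unique (positions b w)
unique-positions b []      = []
unique-positions b (x ∷ w) with x ≟ᵇ b
... | yes _ = AllP.map⁺ (All.universal (λ _ ()) _) ∷ UniqueP.map⁺ ℕP.suc-injective (unique-positions b w)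
... | no  _ = UniqueP.map⁺ ℕP.suc-injective (unique-positions b w)

positions-sound : ∀ b w {i} → i ∈ positions b w → head (drop i w) ≡ just b
positions-sound b (x ∷ w) p with x ≟ᵇ b
positions-sound b (x ∷ w) (here refl) | yes x≡b = cong just x≡b
positions-sound b (x ∷ w) (there p)   | yes _ with ∈-map⁻ suc p
... | j , j∈ , refl = positions-sound b w j∈
positions-sound b (x ∷ w) p | no _ with ∈-map⁻ suc p
... | j , j∈ , refl = positions-sound b w j∈

positions-complete : ∀ b w {i} → head (drop i w) ≡ just b → i ∈ positions b w
positions-complete b (x ∷ w) {zero} h with x ≟ᵇ b
... | yes _   = here refl
... | no  x≢b = ⊥-elim (x≢b (just-injective h))
positions-complete b (x ∷ w) {suc i} h with x ≟ᵇ b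
... | yes _ = there (∈-map⁺ suc (positions-complete b w h))
... | no  _ = ∈-map⁺ suc (positions-complete b w h)

flipHead : Word → Word
flipHead []      = []
flipHead (x ∷ u) = not x ∷ u

flipHead-involutive : ∀ u → flipHead (flipHead u) ≡ u
flipHead-involutive []      = refl
flipHead-involutive (x ∷ u) = cong (_∷ u) (not-involutive x)

length-flipHead : ∀ u → length (flipHead u) ≡ length u
length-flipHead []      = refl
length-flipHead (x ∷ u) = refl

head-flipHead : ∀ u → head (flipHead u) ≡ Maybe.map not (head u)
head-flipHead []      = refl
head-flipHead (x ∷ u) = refl

-- Needed to see that the length-n windows fit inside D ++ D.
n<2^n : ∀ n → n < 2 ^ n
n<2^n zero    = z<s
n<2^n (suc n) = subst (suc (suc n) ≤_) (cong (2 ^ n ℕ.+_) (sym (ℕP.+-identityʳ (2 ^ n))))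
  (ℕP.+-mono-≤ (ℕP.m^n>0 2 n) (n<2^n n))

module DeBruijn (m : ℕ) (D : Word) (deBruijn : IsDeBruijn (suc m) D) where

  n : ℕ
  n = suc m

  L : ℕ
  L = length D

  n≤L : n ≤ L
  n≤L = subst (n ≤_) (sym (proj₁ deBruijn)) (ℕP.<⇒≤ (n<2^n n))

  window : ℕ → Word
  window i = csubAt D i n

  length-window : ∀ {i} → i < L → length (window i) ≡ n
  length-window {i} i< = trans (length-take n (drop i (D ++ D))) (ℕP.m≤n⇒m⊓n≡m n≤rest)
    where
    open ℕP.≤-Reasoning
    n≤rest : n ≤ length (drop i (D ++ D))
    n≤rest = begin
      n                          ≤⟨ n≤L ⟩
      L                          ≤⟨ ℕP.m≤m+n L (L ∸ i) ⟩
      L ℕ.+ (L ∸ i)              ≡⟨ ℕP.+-∸-assoc L (ℕP.<⇒≤ i<) ⟨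
      (L ℕ.+ L) ∸ i              ≡⟨ cong (_∸ i) (length-++ D) ⟨
      length (D ++ D) ∸ i        ≡⟨ length-drop i (D ++ D) ⟨
      length (drop i (D ++ D))   ∎

  head-window : ∀ {i} → i < L → head (window i) ≡ head (drop i D)
  head-window {i} i< = trans (head-take-suc m (drop i (D ++ D))) (head-drop-++ i D D i<)

  unique-occurrence : ∀ u → length u ≡ n →
    ∃ λ j → j < L × window j ≡ u × (∀ {i} → i < L → window i ≡ u → i ≡ j)
  unique-occurrence u len
    with filter-singleton (λ i → ≡-dec _≟ᵇ_ (csubAt D i (length u)) u) (upTo L) (proj₂ deBruijn u len)
  ... | j , j∈ , at-j , unique =
    j , ∈-upTo⁻ j∈ , subst (λ k → csubAt D j k ≡ u) len at-j ,
    λ {i} i< at-i → unique (∈-upTo⁺ i<) (subst (λ k → csubAt D i k ≡ u) (sym len) at-i)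

  window-injective : ∀ {i i′} → i < L → i′ < L → window i ≡ window i′ → i ≡ i′
  window-injective {i} i< i′< eq with unique-occurrence (window i) (length-window i<)
  ... | _ , _ , _ , unique = trans (unique i< refl) (sym (unique i′< (sym eq)))

  flipped-occurrence : ∀ {i} → i < L → ∃ λ j → j < L × window j ≡ flipHead (window i)
  flipped-occurrence {i} i< with unique-occurrence (flipHead (window i)) (trans (length-flipHead (window i)) (length-window i<))
  ... | j , j< , at-j , _ = j , j< , at-j

  partner : ∀ {i} → i < L → ℕ
  partner i< = proj₁ (flipped-occurrence i<)

  partner< : ∀ {i} (i< : i < L) → partner i< < L
  partner< i< = proj₁ (proj₂ (flipped-occurrence i<))

  partner-window : ∀ {i} (i< : i < L) → window (partner i<) ≡ flipHead (window i)
  partner-window i< = proj₂ (proj₂ (flipped-occurrence i<))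

  partner-carries : ∀ {i b} (i< : i < L) → head (drop i D) ≡ just b →
                    head (drop (partner i<) D) ≡ just (not b)
  partner-carries {i} {b} i< h = begin
    head (drop (partner i<) D)        ≡⟨ head-window (partner< i<) ⟨
    head (window (partner i<))        ≡⟨ cong head (partner-window i<) ⟩
    head (flipHead (window i))        ≡⟨ head-flipHead (window i) ⟩
    Maybe.map not (head (window i))   ≡⟨ cong (Maybe.map not) (trans (head-window i<) h) ⟩
    just (not b)                      ∎
    where open ≡-Reasoning

  partner-injective : ∀ {i i′} (i< : i < L) (i′< : i′ < L) → partner i< ≡ partner i′< → i ≡ i′
  partner-injective {i} {i′} i< i′< eq = window-injective i< i′< (begin
    window i                               ≡⟨ flipHead-involutive (window i) ⟨
    flipHead (flipHead (window i))         ≡⟨ cong flipHead (partner-window i<) ⟨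
    flipHead (window (partner i<))         ≡⟨ cong (flipHead ∘ window) eq ⟩
    flipHead (window (partner i′<))        ≡⟨ cong flipHead (partner-window i′<) ⟩
    flipHead (flipHead (window i′))        ≡⟨ flipHead-involutive (window i′) ⟩
    window i′                              ∎)
    where open ≡-Reasoning

  -- Partners inject the positions of b into those of ¬b.
  count-≤ : ∀ b → count b D ≤ count (not b) D
  count-≤ b = subst₂ _≤_ (length-positions b D) (length-positions (not b) D)
    (injection-length (unique-positions b D) (λ p → partner (position< p))
      (λ p → positions-complete (not b) D (partner-carries (position< p) (positions-sound b D p)))
      (λ p q → partner-injective (position< p) (position< q)))
    where
    position< : ∀ {i} → i ∈ positions b D → i < L
    position< p = head-drop⇒< _ D (positions-sound b D p)

  balanced : weight D ≡ + 0
  balanced = trans (cong (λ k → + count₁ D - + k) (sym count₁≡count₀)) (ℤP.+-inverseʳ (+ count₁ D))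
    where
    count₁≡count₀ : count₁ D ≡ count₀ D
    count₁≡count₀ = ℕP.≤-antisym (count-≤ true) (count-≤ false)

lemma2 : (n : ℕ) → n ≥ 1 → (D : Word) → IsDeBruijn n D →
    + disc D ≡ d₀ D + d₁ D
lemma2 zero    ()
lemma2 (suc m) _ D deBruijn = balanced-disc D (DeBruijn.balanced m D deBruijn)
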